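{- In every model of $T_1$, the closure of $\{f,g,S,P\}$ (the interpretations of these function symbols) under composition is an Abelian group.
   Context: For a linear order $<$ write $C_<(a,b,c)$ iff $(a<b<c)\lor(b<c<a)\lor(c<a<b)$, and $C_<(a,-,b)=\{x: C_<(a,x,b)\}$. For a language $\mathcal{L}\ni<$, $T^{omin}_{\mathcal{L}}$ is the set of $\mathcal{L}$-sentences true in every o-minimal $\mathcal{L}$-structure. Let $\mathcal{L}_0=\{<,Z,S,P,\pi,c_1,c_2,c_3,c_4\}$ ($<$ binary relation, $Z$ unary predicate, $S,P,\pi$ unary function symbols, $c_i$ constants). $T_0$ is the $\mathcal{L}_0$-theory: (1) $T^{omin}_{\mathcal{L}_0}$; (2) $<$ is a dense linear order without endpoints; (3) every non-maximal (non-minimal) element of $Z$ has an immediate successor (predecessor) in $Z$; (4) every $x\notin Z$ lies in an open interval disjoint from $Z$; (5) $\min Z=c_1$, $\max Z=c_4$; (6) $c_2,c_3\in Z$, $c_1<c_2<c_3<c_4$, and there are infinitely many elements of $Z$ between any two of $c_1,\dots,c_4$; (7) for all $x$: $\pi(x)\in Z$ and there is no $y\in Z$ with $C_<(x,y,\pi(x))$; (8) $S(x)=y$ iff $(x\notin Z\land x=y)\lor(x\in Z\land y\in Z\land\neg\exists z\in Z\,C_<(x,z,y))$, and $P=S^{ -1}$. Let $\mathcal{L}_1=\mathcal{L}_0\cup\{f,g\}$ with $f,g$ unary function symbols; $T_1$ is $T_0$ together with: (9) $f$ is bijective and $g=f^{ -1}$; (10) $f$ maps $Z\cap[c_1,c_2]$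 onto $Z\cap[c_3,c_4]$ order-preservingly; (11) $f$ maps $Z\cap(c_2,c_4]$ onto $Z\cap[c_1,c_3)$ order-preservingly; (12) for all $n>1$ and $z\in Z$, both $Z\cap C_<(z,-,f^n(z))$ and $Z\cap C_<(f^n(z),-,z)$ are infinite; (13) $f(x)=x$ for $x\notin Z$; (14) $C_<(f^m(z),f^n(z),z)$ for all $m>n>0$ and $z\in Z$. -}

module Defs where

open import Level using (0ℓ)
open import Data.Nat using (ℕ; zero; suc) renaming (_<_ to _<ℕ_)
open import Data.Fin using (Fin; zero; suc; toℕ)
open import Data.Product using (Σ; ∃; _×_; _,_; proj₁)
open import Data.Sum using (_⊎_)
open import Data.Empty using (⊥)
open import Data.Unit using (⊤)
open import Data.List using (List)
open import Data.List.Relation.Unary.Any using (Any)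
open import Relation.Nullary using (¬_)
open import Relation.Binary.PropositionalEquality using (_≡_; _≢_)
open import Function.Base using (_∘_)

_⇔'_ : Set → Set → Set
A ⇔' B = (A → B) × (B → A)

Cyc : {A : Set} → (A → A → Set) → A → A → A → Set
Cyc _<_ a b c = (a < b × b < c) ⊎ (b < c × c < a) ⊎ (c < a × a < b)

IsLinear : {A : Set} → (A → A → Set) → Set
IsLinear {A} _<_ =
  ((x : A) → ¬ (x < x)) ×
  ((x y z : A) → x < y → y < z → x < z) ×
  ((x y : A) → x < y ⊎ x ≡ y ⊎ y < x)

-- "infinitely many elements satisfy Q" (the first-order scheme:
-- for every k there are k pairwise distinct such elements)
Infinite : {A : Set} → (A → Set) → Set
Infinite {A} Q = (k : ℕ) → Σ (Fin k → A) λ v →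
  ((i : Fin k) → Q (v i)) × ((i j : Fin k) → v i ≡ v j → i ≡ j)

iter : {A : Set} → ℕ → (A → A) → A → A
iter zero    h x = x
iter (suc n) h x = h (iter n h x)

data Fun0 : Set where
  symS symP symπ : Fun0

-- terms with n free variables (de Bruijn); constants c_{i+1} = con i
data Term (n : ℕ) : Set where
  var : Fin n → Term n
  con : Fin 4 → Term n
  app : Fun0 → Term n → Term n

data Formula : ℕ → Set where
  _≐_  : {n : ℕ} → Term n → Term n → Formula n
  _≺_  : {n : ℕ} → Term n → Term n → Formula n
  isZ  : {n : ℕ} → Term n → Formula n
  ⊥f   : {n : ℕ} → Formula n
  _⇒_  : {n : ℕ} → Formula n → Formula n → Formula n
  _∧f_ : {n : ℕ} → Formula n → Formula n → Formula n
  _∨f_ : {n : ℕ} → Formula n → Formula n → Formula n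
  ∀f   : {n : ℕ} → Formula (suc n) → Formula n
  ∃f   : {n : ℕ} → Formula (suc n) → Formula n

Sentence : Set
Sentence = Formula 0

-- L₀-structures (equality is interpreted as ≡)
record Str0 : Set₁ where
  field
    Carrier : Set
    _<_     : Carrier → Carrier → Set
    Z       : Carrier → Set
    S P π   : Carrier → Carrier
    c       : Fin 4 → Carrier   -- c zero = c₁, …, c 3 = c₄

extend : {A : Set} {n : ℕ} → A → (Fin n → A) → Fin (suc n) → A
extend a ρ zero    = a
extend a ρ (suc i) = ρ i

module _ (M : Str0) where
  open Str0 M

  funOf : Fun0 → Carrier → Carrier
  funOf symS = S
  funOf symP = P
  funOf symπ = π

  evalT : {n : ℕ} → (Fin n → Carrier) → Term n → Carrier
  evalT ρ (var i)   = ρ i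
  evalT ρ (con i)   = c i
  evalT ρ (app F t) = funOf F (evalT ρ t)

  Sat : {n : ℕ} → (Fin n → Carrier) → Formula n → Set
  Sat ρ (t ≐ u)   = evalT ρ t ≡ evalT ρ u
  Sat ρ (t ≺ u)   = evalT ρ t < evalT ρ u
  Sat ρ (isZ t)   = Z (evalT ρ t)
  Sat ρ ⊥f        = ⊥
  Sat ρ (φ ⇒ ψ)   = Sat ρ φ → Sat ρ ψ
  Sat ρ (φ ∧f ψ)  = Sat ρ φ × Sat ρ ψ
  Sat ρ (φ ∨f ψ)  = Sat ρ φ ⊎ Sat ρ ψ
  Sat ρ (∀f φ)    = (a : Carrier) → Sat (extend a ρ) φ
  Sat ρ (∃f φ)    = Σ Carrier λ a → Sat (extend a ρ) φ

  ⊨_ : Sentence → Set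
  ⊨ φ = Sat (λ ()) φ

  data ExtPt : Set where
    -∞ +∞ : ExtPt
    fin   : Carrier → ExtPt

  Above : ExtPt → Carrier → Set
  Above -∞      x = ⊤
  Above +∞      x = ⊥
  Above (fin a) x = a < x

  Below : ExtPt → Carrier → Set
  Below -∞      x = ⊥
  Below +∞      x = ⊤
  Below (fin a) x = x < a

  data Piece : Set where
    point    : Carrier → Piece
    interval : ExtPt → ExtPt → Piece

  InPiece : Carrier → Piece → Set
  InPiece x (point a)      = x ≡ a
  InPiece x (interval l u) = Above l x × Below u x

  OMinimal : Set
  OMinimal = IsLinear _<_ ×
    ((k : ℕ) (φ : Formula (suc k)) (a : Fin k → Carrier) →
      Σ (List Piece) λ ps → (x : Carrier) →
        Sat (extend x a) φ ⇔' Any (InPiece x) ps)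

InTomin : Sentence → Set₁
InTomin φ = (N : Str0) → OMinimal N → ⊨_ N φ

module _ (M : Str0) where
  open Str0 M

  c₁ c₂ c₃ c₄ : Carrier
  c₁ = c zero
  c₂ = c (suc zero)
  c₃ = c (suc (suc zero))
  c₄ = c (suc (suc (suc zero)))

  _≤_ : Carrier → Carrier → Set
  x ≤ y = x ≡ y ⊎ x < y

  C : Carrier → Carrier → Carrier → Set
  C = Cyc _<_

  MapsOntoMono : (Carrier → Carrier) → (Carrier → Set) → (Carrier → Set) → Set
  MapsOntoMono h A B =
    ((x : Carrier) → A x → B (h x)) ×
    ((y : Carrier) → B y → Σ Carrier λ x → A x × h x ≡ y) ×
    ((x x' : Carrier) → A x → A x' → x < x' → h x < h x')

  record IsT1Model (f g : Carrier → Carrier) : Set₁ where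
    field
      ax1  : (φ : Sentence) → InTomin φ → ⊨_ M φ
      ax2-linear : IsLinear _<_
      ax2-dense  : (x y : Carrier) → x < y → Σ Carrier λ z → x < z × z < y
      ax2-noMin  : (x : Carrier) → Σ Carrier λ y → y < x
      ax2-noMax  : (x : Carrier) → Σ Carrier λ y → x < y
      ax3-succ : (x : Carrier) → Z x → (Σ Carrier λ w → Z w × x < w) →
        Σ Carrier λ y → Z y × x < y ×
          ¬ (Σ Carrier λ w → Z w × x < w × w < y)
      ax3-pred : (x : Carrier) → Z x → (Σ Carrier λ w → Z w × w < x) →
        Σ Carrier λ y → Z y × y < x ×
          ¬ (Σ Carrier λ w → Z w × y < w × w < x)
      ax4 : (x : Carrier) → ¬ Z x → Σ Carrier λ a → Σ Carrier λ b →
        a < x × x < b × ((y : Carrier) → a < y → y < b → ¬ Z y)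
      ax5-min : Z c₁ × ((z : Carrier) → Z z → c₁ ≤ z)
      ax5-max : Z c₄ × ((z : Carrier) → Z z → z ≤ c₄)
      ax6-Z     : Z c₂ × Z c₃
      ax6-order : c₁ < c₂ × c₂ < c₃ × c₃ < c₄
      ax6-inf   : (i j : Fin 4) → toℕ i <ℕ toℕ j →
        Infinite (λ z → Z z × c i < z × z < c j)
      ax7 : (x : Carrier) → Z (π x) × ¬ (Σ Carrier λ y → Z y × C x y (π x))
      -- (8)  (READING: y ≢ x added in the Z-case)
      ax8-S : (x y : Carrier) → (S x ≡ y) ⇔'
        ((¬ Z x × x ≡ y) ⊎
         (Z x × Z y × x ≢ y × ¬ (Σ Carrier λ z → Z z × C x z y)))
      ax8-P : (x y : Carrier) → (P x ≡ y) ⇔' (S y ≡ x)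
      ax9-inj  : (x y : Carrier) → f x ≡ f y → x ≡ y
      ax9-surj : (y : Carrier) → Σ Carrier λ x → f x ≡ y
      ax9-g    : (x y : Carrier) → (g x ≡ y) ⇔' (f y ≡ x)
      ax10 : MapsOntoMono f (λ x → Z x × c₁ ≤ x × x ≤ c₂)
                            (λ x → Z x × c₃ ≤ x × x ≤ c₄)
      ax11 : MapsOntoMono f (λ x → Z x × c₂ < x × x ≤ c₄)
                            (λ x → Z x × c₁ ≤ x × x < c₃)
      ax12 : (n : ℕ) → 1 <ℕ n → (z : Carrier) → Z z →
        Infinite (λ y → Z y × C z y (iter n f z)) ×
        Infinite (λ y → Z y × C (iter n f z) y z)
      ax13 : (x : Carrier) → ¬ Z x → f x ≡ x
      ax14 : (m n : ℕ) → n <ℕ m → 0 <ℕ n → (z : Carrier) → Z z →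
        C (iter m f z) (iter n f z) z

module _ {A : Set} (h₁ h₂ h₃ h₄ : A → A) where

  data InClosure : (A → A) → Set where
    gen₁ : InClosure h₁
    gen₂ : InClosure h₂
    gen₃ : InClosure h₃
    gen₄ : InClosure h₄
    comp : {u v : A → A} → InClosure u → InClosure v → InClosure (u ∘ v)

  Closure : Set
  Closure = Σ (A → A) InClosure

  _≈ᶜ_ : Closure → Closure → Set
  u ≈ᶜ v = (x : A) → proj₁ u x ≡ proj₁ v x

  _∘ᶜ_ : Closure → Closure → Closure
  (u , p) ∘ᶜ (v , q) = (u ∘ v , comp p q)

module Submission where

-- Since g = f⁻¹ and P = S⁻¹, the closure is an abelian group as soon as f and S commute.
-- Off Z both f and S are the identity.  On Z, S is the cyclic successor, and f restricts
-- to order isomorphisms of Z ∩ [c₁,c₂] onto Z ∩ [c₃,c₄] and of Z ∩ (c₂,c₄] onto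
-- Z ∩ [c₁,c₃); both targets are convex in Z, so f maps consecutive elements of Z to
-- consecutive ones.  At the two seams the consecutive pairs (c₂, S c₂) and (c₄, c₁) go to
-- (c₄, c₁) and (f c₄, c₃), again consecutive because f c₄ is the largest element of Z
-- below c₃.  Hence f (S x) = S (f x).

open import Defs hiding (c₁; c₂; c₃; c₄; _≤_; C)
open import Level using (0ℓ)
open import Data.Product using (Σ; _×_; _,_; proj₁; proj₂)
open import Data.Sum using (_⊎_; inj₁; inj₂)
open import Data.Empty using (⊥; ⊥-elim)
open import Relation.Nullary using (¬_; yes; no)
open import Axiom.ExcludedMiddle using (ExcludedMiddle)
open import Function.Base using (_∘_)
open import Relation.Binary.PropositionalEquality
  using (_≡_; _≢_; refl; sym; trans; cong; subst; subst₂; _→-setoid_; module ≡-Reasoning)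
open import Relation.Binary.Bundles using (Setoid)
import Relation.Binary.Construct.On as On
open import Algebra.Structures using (IsAbelianGroup)

module _ {A : Set} where

  record Commute (u v : A → A) : Set where
    constructor mkCommute
    field commute : ∀ x → u (v x) ≡ v (u x)

  record Inverses (u v : A → A) : Set where
    constructor mkInverses
    field
      inverseˡ : ∀ x → u (v x) ≡ x
      inverseʳ : ∀ x → v (u x) ≡ x

  open Commute
  open Inverses

  inverses-sym : {u v : A → A} → Inverses u v → Inverses v u
  inverses-sym (mkInverses uv vu) = mkInverses vu uv

  inverses-∘ : {u u′ v v′ : A → A} → Inverses u u′ → Inverses v v′ →
    Inverses (u ∘ v) (v′ ∘ u′)
  inverses-∘ {u} {u′} {v} {v′} (mkInverses uu′ u′u) (mkInverses vv′ v′v) = mkInverses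
    (λ x → trans (cong u (vv′ (u′ x))) (uu′ x))
    (λ x → trans (cong v′ (u′u (v x))) (v′v x))

  inverses-cong : {u u′ v v′ : A → A} → Inverses u u′ → Inverses v v′ →
    (∀ x → u x ≡ v x) → ∀ x → u′ x ≡ v′ x
  inverses-cong {u} {u′} {v} {v′} uu′ vv′ u≗v x = begin
    u′ x              ≡⟨ cong u′ (sym (inverseˡ vv′ x)) ⟩
    u′ (v (v′ x))     ≡⟨ cong u′ (sym (u≗v (v′ x))) ⟩
    u′ (u (v′ x))     ≡⟨ inverseʳ uu′ (v′ x) ⟩
    v′ x              ∎
    where open ≡-Reasoning

  commute-refl : (u : A → A) → Commute u u
  commute-refl u = mkCommute λ x → refl

  commute-sym : {u v : A → A} → Commute u v → Commute v u
  commute-sym uv = mkCommute λ x → sym (commute uv x)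

  commute-∘ˡ : {u v w : A → A} → Commute u w → Commute v w → Commute (u ∘ v) w
  commute-∘ˡ {u} {v} uw vw = mkCommute λ x → trans (cong u (commute vw x)) (commute uw (v x))

  commute-inverseʳ : {u v v′ : A → A} → Commute u v → Inverses v v′ → Commute u v′
  commute-inverseʳ {u} {v} {v′} uv vv′ = mkCommute λ x → begin
    u (v′ x)             ≡⟨ sym (inverseʳ vv′ (u (v′ x))) ⟩
    v′ (v (u (v′ x)))    ≡⟨ cong v′ (sym (commute uv (v′ x))) ⟩
    v′ (u (v (v′ x)))    ≡⟨ cong (v′ ∘ u) (inverseˡ vv′ x) ⟩
    v′ (u x)             ∎
    where open ≡-Reasoning

  commute-inverseˡ : {u u′ v : A → A} → Commute u v → Inverses u u′ → Commute u′ v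
  commute-inverseˡ uv uu′ = commute-sym (commute-inverseʳ (commute-sym uv) uu′)

  module _ {h₁ h₂ h₃ h₄ : A → A}
           (h₁h₂ : Inverses h₁ h₂) (h₃h₄ : Inverses h₃ h₄) (h₁h₃ : Commute h₁ h₃) where

    commute-closure : {h u : A → A} → Commute h h₁ → Commute h h₃ →
      InClosure h₁ h₂ h₃ h₄ u → Commute h u
    commute-closure hh₁ hh₃ gen₁ = hh₁
    commute-closure hh₁ hh₃ gen₂ = commute-inverseʳ hh₁ h₁h₂
    commute-closure hh₁ hh₃ gen₃ = hh₃
    commute-closure hh₁ hh₃ gen₄ = commute-inverseʳ hh₃ h₃h₄
    commute-closure hh₁ hh₃ (comp p q) =
      commute-sym (commute-∘ˡ (commute-sym (commute-closure hh₁ hh₃ p))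
                              (commute-sym (commute-closure hh₁ hh₃ q)))

    closure-commute : {u v : A → A} →
      InClosure h₁ h₂ h₃ h₄ u → InClosure h₁ h₂ h₃ h₄ v → Commute u v
    closure-commute gen₁ = commute-closure (commute-refl h₁) h₁h₃
    closure-commute gen₂ = commute-closure (commute-inverseˡ (commute-refl h₁) h₁h₂)
                                           (commute-inverseˡ h₁h₃ h₁h₂)
    closure-commute gen₃ = commute-closure (commute-sym h₁h₃) (commute-refl h₃)
    closure-commute gen₄ = commute-closure (commute-inverseˡ (commute-sym h₁h₃) h₃h₄)
                                           (commute-inverseˡ (commute-refl h₃) h₃h₄)
    closure-commute (comp p q) r = commute-∘ˡ (closure-commute p r) (closure-commute q r)

    closure-inverse : {u : A → A} → InClosure h₁ h₂ h₃ h₄ u →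
      Σ (A → A) λ v → InClosure h₁ h₂ h₃ h₄ v × Inverses u v
    closure-inverse gen₁ = h₂ , gen₂ , h₁h₂
    closure-inverse gen₂ = h₁ , gen₁ , inverses-sym h₁h₂
    closure-inverse gen₃ = h₄ , gen₄ , h₃h₄
    closure-inverse gen₄ = h₃ , gen₃ , inverses-sym h₃h₄
    closure-inverse (comp p q) with closure-inverse p | closure-inverse q
    ... | u′ , p′ , uu′ | v′ , q′ , vv′ = v′ ∘ u′ , comp q′ p′ , inverses-∘ uu′ vv′

    closure-isAbelianGroup :
      Σ (Closure h₁ h₂ h₃ h₄) λ ε →
        Σ (Closure h₁ h₂ h₃ h₄ → Closure h₁ h₂ h₃ h₄) λ inv →
          IsAbelianGroup (_≈ᶜ_ h₁ h₂ h₃ h₄) (_∘ᶜ_ h₁ h₂ h₃ h₄) ε inv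
    closure-isAbelianGroup = ε , inv , record
      { isGroup = record
        { isMonoid = record
          { isSemigroup = record
            { isMagma = record
              { isEquivalence = On.isEquivalence proj₁ (Setoid.isEquivalence (A →-setoid A))
              ; ∙-cong = λ { {u , _} {_} {_} {v′ , _} u≈u′ v≈v′ x →
                               trans (cong u (v≈v′ x)) (u≈u′ (v′ x)) } }
            ; assoc = λ _ _ _ x → refl }
          ; identity = (λ u x → inverseˡ h₁h₂ (proj₁ u x)) ,
                       (λ u x → cong (proj₁ u) (inverseˡ h₁h₂ x)) }
        ; inverse = (λ u x → trans (inverseʳ (inv-inverses u) x) (sym (inverseˡ h₁h₂ x))) ,
                    (λ u x → trans (inverseˡ (inv-inverses u) x) (sym (inverseˡ h₁h₂ x)))
        ; ⁻¹-cong = λ {u} {v} → inverses-cong (inv-inverses u) (inv-inverses v) }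
      ; comm = λ { (u , p) (v , q) → commute (closure-commute p q) } }
      where
      ε : Closure h₁ h₂ h₃ h₄
      ε = h₁ ∘ h₂ , comp gen₁ gen₂

      inv : Closure h₁ h₂ h₃ h₄ → Closure h₁ h₂ h₃ h₄
      inv (u , p) = let (v , q , _) = closure-inverse p in v , q

      inv-inverses : (u : Closure h₁ h₂ h₃ h₄) → Inverses (proj₁ u) (proj₁ (inv u))
      inv-inverses (u , p) = proj₂ (proj₂ (closure-inverse p))

module LinearlyOrdered (M : Str0) (linear : IsLinear (Str0._<_ M)) where
  open Str0 M

  _≤_ : Carrier → Carrier → Set
  _≤_ = Defs._≤_ M

  C : Carrier → Carrier → Carrier → Set
  C = Defs.C M

  <-irrefl : ∀ x → ¬ x < x
  <-irrefl = proj₁ linear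

  <-trans : ∀ {x y z} → x < y → y < z → x < z
  <-trans = proj₁ (proj₂ linear) _ _ _

  <-cmp : ∀ x y → x < y ⊎ x ≡ y ⊎ y < x
  <-cmp = proj₂ (proj₂ linear)

  <-asym : ∀ {x y} → x < y → ¬ y < x
  <-asym x<y y<x = <-irrefl _ (<-trans x<y y<x)

  <-≤-trans : ∀ {x y z} → x < y → y ≤ z → x < z
  <-≤-trans x<y (inj₁ refl) = x<y
  <-≤-trans x<y (inj₂ y<z) = <-trans x<y y<z

  ≤-<-trans : ∀ {x y z} → x ≤ y → y < z → x < z
  ≤-<-trans (inj₁ refl) y<z = y<z
  ≤-<-trans (inj₂ x<y) y<z = <-trans x<y y<z

  <⇒≱ : ∀ {x y} → x < y → ¬ y ≤ x
  <⇒≱ x<x (inj₁ refl) = <-irrefl _ x<x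
  <⇒≱ x<y (inj₂ y<x) = <-asym x<y y<x

  ≤-antisym : ∀ {x y} → x ≤ y → y ≤ x → x ≡ y
  ≤-antisym (inj₁ x≡y) _ = x≡y
  ≤-antisym (inj₂ x<y) y≤x = ⊥-elim (<⇒≱ x<y y≤x)

  StrictlyMonotoneOn : (Carrier → Set) → (Carrier → Carrier) → Set
  StrictlyMonotoneOn D h = ∀ x x′ → D x → D x′ → x < x′ → h x < h x′

  module _ {D : Carrier → Set} {h : Carrier → Carrier} (mono : StrictlyMonotoneOn D h) where

    monotone-≤ : ∀ {a b} → D a → D b → a ≤ b → h a ≤ h b
    monotone-≤ _ _ (inj₁ refl) = inj₁ refl
    monotone-≤ Da Db (inj₂ a<b) = inj₂ (mono _ _ Da Db a<b)

    monotone-reflects-< : ∀ {a b} → D a → D b → h a < h b → a < b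
    monotone-reflects-< {a} {b} Da Db ha<hb with <-cmp a b
    ... | inj₁ a<b = a<b
    ... | inj₂ (inj₁ refl) = ⊥-elim (<-irrefl _ ha<hb)
    ... | inj₂ (inj₂ b<a) = ⊥-elim (<-asym ha<hb (mono _ _ Db Da b<a))

  module _ {h : Carrier → Carrier} {D E : Carrier → Set} where

    image-of-max : MapsOntoMono M h D E → ∀ {m} → D m → (∀ y → D y → y ≤ m) →
      ∀ w → E w → w ≤ h m
    image-of-max (_ , onto , mono) Dm max w Ew with onto w Ew
    ... | y , Dy , refl = monotone-≤ mono Dy Dm (max y Dy)

    image-of-min : MapsOntoMono M h D E → ∀ {m} → D m → (∀ y → D y → m ≤ y) →
      ∀ w → E w → h m ≤ w
    image-of-min (_ , onto , mono) Dm min w Ew with onto w Ew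
    ... | y , Dy , refl = monotone-≤ mono Dm Dy (min y Dy)

  NoZBetween : Carrier → Carrier → Set
  NoZBetween a b = ∀ w → Z w → a < w → w < b → ⊥

  NoZCyclicallyBetween : Carrier → Carrier → Set
  NoZCyclicallyBetween a b = ¬ Σ Carrier λ w → Z w × C a w b

  noZCyclicallyBetween⇒noZBetween : ∀ {a b} → NoZCyclicallyBetween a b → NoZBetween a b
  noZCyclicallyBetween⇒noZBetween gap w Zw a<w w<b = gap (w , Zw , inj₁ (a<w , w<b))

  noZBetween⇒noZCyclicallyBetween : ∀ {a b} → a < b → NoZBetween a b → NoZCyclicallyBetween a b
  noZBetween⇒noZCyclicallyBetween a<b gap (w , Zw , inj₁ (a<w , w<b)) = gap w Zw a<w w<b
  noZBetween⇒noZCyclicallyBetween a<b gap (w , Zw , inj₂ (inj₁ (_ , b<a))) = <-asym a<b b<a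
  noZBetween⇒noZCyclicallyBetween a<b gap (w , Zw , inj₂ (inj₂ (b<a , _))) = <-asym a<b b<a

  ConvexInZ : (Carrier → Set) → Set
  ConvexInZ E = ∀ u v w → E u → E v → Z w → u < w → w < v → E w

  maps-preserve-gaps : ∀ {h : Carrier → Carrier} {D E : Carrier → Set} →
    MapsOntoMono M h D E → (∀ y → D y → Z y) → ConvexInZ E →
    ∀ {x y} → D x → D y → x < y → NoZCyclicallyBetween x y → NoZCyclicallyBetween (h x) (h y)
  maps-preserve-gaps {h} (into , onto , mono) D⊆Z convex {x} {y} Dx Dy x<y gap =
    noZBetween⇒noZCyclicallyBetween (mono x y Dx Dy x<y) no-preimage
    where
    no-preimage : NoZBetween (h x) (h y)
    no-preimage w Zw hx<w w<hy with onto w (convex _ _ w (into x Dx) (into y Dy) Zw hx<w w<hy)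
    ... | z , Dz , refl =
      noZCyclicallyBetween⇒noZBetween gap z (D⊆Z z Dz)
        (monotone-reflects-< mono Dx Dz hx<w) (monotone-reflects-< mono Dz Dy w<hy)

module T1Model (M : Str0) (f g : Str0.Carrier M → Str0.Carrier M) (T : IsT1Model M f g) where
  open Str0 M
  open IsT1Model T
  open LinearlyOrdered M ax2-linear

  c₁ c₂ c₃ c₄ : Carrier
  c₁ = Defs.c₁ M
  c₂ = Defs.c₂ M
  c₃ = Defs.c₃ M
  c₄ = Defs.c₄ M

  Z-c₁ : Z c₁
  Z-c₁ = proj₁ ax5-min

  Z-c₂ : Z c₂
  Z-c₂ = proj₁ ax6-Z

  Z-c₃ : Z c₃
  Z-c₃ = proj₂ ax6-Z

  Z-c₄ : Z c₄
  Z-c₄ = proj₁ ax5-max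

  c₁-least : ∀ {z} → Z z → c₁ ≤ z
  c₁-least = proj₂ ax5-min _

  c₄-greatest : ∀ {z} → Z z → z ≤ c₄
  c₄-greatest = proj₂ ax5-max _

  c₁<c₂ : c₁ < c₂
  c₁<c₂ = proj₁ ax6-order

  c₂<c₃ : c₂ < c₃
  c₂<c₃ = proj₁ (proj₂ ax6-order)

  c₃<c₄ : c₃ < c₄
  c₃<c₄ = proj₂ (proj₂ ax6-order)

  c₂<c₄ : c₂ < c₄
  c₂<c₄ = <-trans c₂<c₃ c₃<c₄

  c₁<c₄ : c₁ < c₄
  c₁<c₄ = <-trans c₁<c₂ c₂<c₄

  Z[c₁,c₂] Z[c₃,c₄] Z]c₂,c₄] Z[c₁,c₃[ : Carrier → Set
  Z[c₁,c₂] x = Z x × c₁ ≤ x × x ≤ c₂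
  Z[c₃,c₄] x = Z x × c₃ ≤ x × x ≤ c₄
  Z]c₂,c₄] x = Z x × c₂ < x × x ≤ c₄
  Z[c₁,c₃[ x = Z x × c₁ ≤ x × x < c₃

  Z[c₃,c₄]-convex : ConvexInZ Z[c₃,c₄]
  Z[c₃,c₄]-convex u v w (_ , c₃≤u , _) (_ , _ , v≤c₄) Zw u<w w<v =
    Zw , inj₂ (≤-<-trans c₃≤u u<w) , inj₂ (<-≤-trans w<v v≤c₄)

  Z[c₁,c₃[-convex : ConvexInZ Z[c₁,c₃[
  Z[c₁,c₃[-convex u v w _ (_ , _ , v<c₃) Zw _ w<v = Zw , c₁-least Zw , <-trans w<v v<c₃

  f-g-inverses : Inverses f g
  f-g-inverses = mkInverses (λ x → proj₁ (ax9-g x (g x)) refl) (λ x → proj₂ (ax9-g (f x) x) refl)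

  S-P-inverses : Inverses S P
  S-P-inverses = mkInverses (λ x → proj₁ (ax8-P x (P x)) refl) (λ x → proj₂ (ax8-P (S x) x) refl)

  S-outside-Z : ∀ {x} → ¬ Z x → S x ≡ x
  S-outside-Z {x} ¬Zx with proj₁ (ax8-S x (S x)) refl
  ... | inj₁ (_ , x≡Sx) = sym x≡Sx
  ... | inj₂ (Zx , _) = ⊥-elim (¬Zx Zx)

  S-successor : ∀ {x} → Z x → Z (S x) × x ≢ S x × NoZCyclicallyBetween x (S x)
  S-successor {x} Zx with proj₁ (ax8-S x (S x)) refl
  ... | inj₁ (¬Zx , _) = ⊥-elim (¬Zx Zx)
  ... | inj₂ (_ , successor) = successor

  S-unique : ∀ {x y} → Z x → Z y → x ≢ y → NoZCyclicallyBetween x y → S x ≡ y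
  S-unique Zx Zy x≢y gap = proj₂ (ax8-S _ _) (inj₂ (Zx , Zy , x≢y , gap))

  S-increasing : ∀ {x} → Z x → x < c₄ → x < S x
  S-increasing {x} Zx x<c₄ with S-successor Zx | <-cmp x (S x)
  ... | _ | inj₁ x<Sx = x<Sx
  ... | (_ , x≢Sx , _) | inj₂ (inj₁ x≡Sx) = ⊥-elim (x≢Sx x≡Sx)
  ... | (_ , _ , gap) | inj₂ (inj₂ Sx<x) = ⊥-elim (gap (c₄ , Z-c₄ , inj₂ (inj₂ (Sx<x , x<c₄))))

  S-least : ∀ {x y} → Z x → Z y → x < y → S x ≤ y
  S-least {x} {y} Zx Zy x<y with S-successor Zx | <-cmp (S x) y
  ... | _ | inj₁ Sx<y = inj₂ Sx<y
  ... | _ | inj₂ (inj₁ Sx≡y) = inj₁ Sx≡y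
  ... | (_ , _ , gap) | inj₂ (inj₂ y<Sx) = ⊥-elim (gap (y , Zy , inj₁ (x<y , y<Sx)))

  no-Z-between-c₄-c₁ : NoZCyclicallyBetween c₄ c₁
  no-Z-between-c₄-c₁ (w , Zw , inj₁ (c₄<w , _)) = <⇒≱ c₄<w (c₄-greatest Zw)
  no-Z-between-c₄-c₁ (w , Zw , inj₂ (inj₁ (w<c₁ , _))) = <⇒≱ w<c₁ (c₁-least Zw)
  no-Z-between-c₄-c₁ (w , Zw , inj₂ (inj₂ (_ , c₄<w))) = <⇒≱ c₄<w (c₄-greatest Zw)

  S-c₄ : S c₄ ≡ c₁
  S-c₄ = S-unique Z-c₄ Z-c₁ (λ c₄≡c₁ → <-irrefl c₁ (subst (c₁ <_) c₄≡c₁ c₁<c₄)) no-Z-between-c₄-c₁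

  S-c₂∈Z]c₂,c₄] : Z]c₂,c₄] (S c₂)
  S-c₂∈Z]c₂,c₄] = let ZSc₂ = proj₁ (S-successor Z-c₂) in
    ZSc₂ , S-increasing Z-c₂ c₂<c₄ , c₄-greatest ZSc₂

  f-Z : ∀ {x} → Z x → Z (f x)
  f-Z {x} Zx with <-cmp x c₂
  ... | inj₁ x<c₂ = proj₁ (proj₁ ax10 x (Zx , c₁-least Zx , inj₂ x<c₂))
  ... | inj₂ (inj₁ x≡c₂) = proj₁ (proj₁ ax10 x (Zx , c₁-least Zx , inj₁ x≡c₂))
  ... | inj₂ (inj₂ c₂<x) = proj₁ (proj₁ ax11 x (Zx , c₂<x , c₄-greatest Zx))

  f-c₁ : f c₁ ≡ c₃
  f-c₁ = ≤-antisym
    (image-of-min ax10 c₁∈Z[c₁,c₂] (λ _ → proj₁ ∘ proj₂) c₃ (Z-c₃ , inj₁ refl , inj₂ c₃<c₄))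
    (proj₁ (proj₂ (proj₁ ax10 c₁ c₁∈Z[c₁,c₂])))
    where
    c₁∈Z[c₁,c₂] : Z[c₁,c₂] c₁
    c₁∈Z[c₁,c₂] = Z-c₁ , inj₁ refl , inj₂ c₁<c₂

  f-c₂ : f c₂ ≡ c₄
  f-c₂ = ≤-antisym
    (c₄-greatest (f-Z Z-c₂))
    (image-of-max ax10 (Z-c₂ , inj₂ c₁<c₂ , inj₁ refl) (λ _ → proj₂ ∘ proj₂) c₄
      (Z-c₄ , inj₂ c₃<c₄ , inj₁ refl))

  f-S-c₂ : f (S c₂) ≡ c₁
  f-S-c₂ = ≤-antisym
    (image-of-min ax11 S-c₂∈Z]c₂,c₄] (λ y (Zy , c₂<y , _) → S-least Z-c₂ Zy c₂<y) c₁
      (Z-c₁ , inj₁ refl , <-trans c₁<c₂ c₂<c₃))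
    (c₁-least (f-Z (proj₁ S-c₂∈Z]c₂,c₄])))

  no-Z-between-f-c₄-c₃ : NoZCyclicallyBetween (f c₄) c₃
  no-Z-between-f-c₄-c₃ = noZBetween⇒noZCyclicallyBetween (proj₂ (proj₂ (proj₁ ax11 c₄ c₄∈Z]c₂,c₄])))
    λ w Zw f-c₄<w w<c₃ →
      <⇒≱ f-c₄<w (image-of-max ax11 c₄∈Z]c₂,c₄] (λ _ → proj₂ ∘ proj₂) w (Zw , c₁-least Zw , w<c₃))
    where
    c₄∈Z]c₂,c₄] : Z]c₂,c₄] c₄
    c₄∈Z]c₂,c₄] = Z-c₄ , c₂<c₄ , inj₁ refl

  f-preserves-successor-gap : ∀ {x} → Z x → NoZCyclicallyBetween (f x) (f (S x))
  f-preserves-successor-gap {x} Zx with S-successor Zx | <-cmp x c₂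
  ... | ZSx , _ , gap | inj₁ x<c₂ =
    maps-preserve-gaps ax10 (λ _ → proj₁) Z[c₃,c₄]-convex
      (Zx , c₁-least Zx , inj₂ x<c₂) (ZSx , c₁-least ZSx , S-least Zx Z-c₂ x<c₂)
      (S-increasing Zx (<-trans x<c₂ c₂<c₄)) gap
  ... | _ | inj₂ (inj₁ refl) = subst₂ NoZCyclicallyBetween (sym f-c₂) (sym f-S-c₂) no-Z-between-c₄-c₁
  ... | ZSx , _ , gap | inj₂ (inj₂ c₂<x) with <-cmp x c₄
  ...   | inj₁ x<c₄ =
    maps-preserve-gaps ax11 (λ _ → proj₁) Z[c₁,c₃[-convex
      (Zx , c₂<x , inj₂ x<c₄) (ZSx , <-trans c₂<x (S-increasing Zx x<c₄) , c₄-greatest ZSx)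
      (S-increasing Zx x<c₄) gap
  ...   | inj₂ (inj₁ refl) = subst (NoZCyclicallyBetween (f c₄)) (sym (trans (cong f S-c₄) f-c₁))
                               no-Z-between-f-c₄-c₃
  ...   | inj₂ (inj₂ c₄<x) = ⊥-elim (<⇒≱ c₄<x (c₄-greatest Zx))

  f-S-commute : ExcludedMiddle 0ℓ → Commute f S
  f-S-commute em = mkCommute f-S
    where
    f-S : ∀ x → f (S x) ≡ S (f x)
    f-S x with em {Z x}
    ... | no ¬Zx = begin
      f (S x)  ≡⟨ cong f (S-outside-Z ¬Zx) ⟩
      f x      ≡⟨ ax13 x ¬Zx ⟩
      x        ≡⟨ sym (S-outside-Z ¬Zx) ⟩
      S x      ≡⟨ cong S (sym (ax13 x ¬Zx)) ⟩
      S (f x)  ∎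
      where open ≡-Reasoning
    ... | yes Zx = let ZSx , x≢Sx , _ = S-successor Zx in
      sym (S-unique (f-Z Zx) (f-Z ZSx) (λ fx≡fSx → x≢Sx (ax9-inj _ _ fx≡fSx))
                    (f-preserves-successor-gap Zx))

mainTheorem12 : ExcludedMiddle 0ℓ → (M : Str0) → (f g : Str0.Carrier M → Str0.Carrier M) → IsT1Model M f g →
    Σ (Closure f g (Str0.S M) (Str0.P M)) λ ε →
      Σ (Closure f g (Str0.S M) (Str0.P M) → Closure f g (Str0.S M) (Str0.P M)) λ inv →
        IsAbelianGroup (_≈ᶜ_ f g (Str0.S M) (Str0.P M)) (_∘ᶜ_ f g (Str0.S M) (Str0.P M)) ε inv
mainTheorem12 em M f g T =
  closure-isAbelianGroup f-g-inverses S-P-inverses (f-S-commute em)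
  where open T1Model M f g T
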